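{- Let $\ell\geq 1$ and $G\in S_{1,\ell}$. Then the complement digraph $\overline{G}$ has at most one weakly connected component that contains arcs.
   Context: A set of sequences $Q$ consists of sequences of pairwise distinct items, each with a type. The sequence digraph $g(Q)$ has as vertex set the set of all types occurring in $Q$, and an arc $(u,v)$ iff $u\neq v$ and in some sequence an item of type $u$ occurs at a position strictly before an item of type $v$. $S_{k,\ell}$ is the class of all digraphs $g(Q)$ with $Q$ consisting of at most $k$ sequences and containing, summed over all sequences, at most $\ell$ items of each type. For $G=(V,A)$, $\overline{G}=(V,\{(u,v)\mid u\neq v,(u,v)\notin A\})$. -}

module Defs where

open import Level using (0ℓ)
open import Data.Nat using (ℕ; _≤_)
open import Data.Fin using (Fin; _≟_) renaming (_<_ to _<ᶠ_)
open import Data.List using (List; length; lookup; filter)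
open import Data.List.Membership.Propositional using (_∈_)
open import Data.Product using (Σ; ∃; _×_)
open import Relation.Nullary using (¬_)
open import Relation.Binary.PropositionalEquality using (_≡_; _≢_)
open import Relation.Binary.Construct.Closure.Symmetric using (SymClosure)
open import Relation.Binary.Construct.Closure.ReflexiveTransitive using (Star)
open import Function.Bundles using (_⇔_)

record Digraph : Set₁ where
  field
    n   : ℕ
    Arc : Fin n → Fin n → Set

open Digraph public

complement : Digraph → Digraph
complement G = record { n = n G ; Arc = λ u v → (u ≢ v) × ¬ Arc G u v }

occurrences : ∀ {n} → Fin n → List (Fin n) → ℕ
occurrences v w = length (filter (_≟ v) w)

-- Arc relation of the sequence digraph of a single sequence w
-- (items are the positions of w; the type of the item at position i is lookup w i).
SeqArc : ∀ {n} → List (Fin n) → Fin n → Fin n → Set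
SeqArc w u v = (u ≢ v) × ∃ λ (i : Fin (length w)) → ∃ λ (j : Fin (length w)) →
                 (i <ᶠ j) × (lookup w i ≡ u) × (lookup w j ≡ v)

-- G ∈ S_{1,ℓ}: G is the sequence digraph g(Q) of a set Q of at most one sequence
-- with at most ℓ items of each type.  Q = ∅ is the case w = [] (then n = 0).
-- The types are identified with the vertices of G (vertex set = set of types
-- occurring in Q).
InS1 : ℕ → Digraph → Set
InS1 ℓ G = ∃ λ (w : List (Fin (n G))) →
             ((v : Fin (n G)) → v ∈ w) ×
             ((v : Fin (n G)) → occurrences v w ≤ ℓ) ×
             ((u v : Fin (n G)) → Arc G u v ⇔ SeqArc w u v)

WeaklyConnected : (G : Digraph) → Fin (n G) → Fin (n G) → Set
WeaklyConnected G = Star (SymClosure (Arc G))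

AtMostOneArcComponent : Digraph → Set
AtMostOneArcComponent G = ∀ {a b c d} → Arc G a b → Arc G c d → WeaklyConnected G a c

module Submission where

-- Let G = g(w) be the sequence digraph of a single sequence w.  An arc u → v
-- of the complement says that u ≠ v and no item of type u precedes an item of
-- type v in w.  Given two complement arcs a → b and c → d, the proof shows
-- that c → b or a → d is a complement arc (or the relevant endpoints
-- coincide), which places a and c in the same weak component.

open import Defs
open import Data.Nat using (ℕ; _≥_)
import Data.Nat.Properties as ℕ
open import Data.Fin using (Fin) renaming (_<_ to _<ᶠ_)
open import Data.Fin.Properties using (any?; _≟_) renaming (_<?_ to _<ᶠ?_)
open import Data.List using (List; lookup)
open import Data.Product using (∃; _×_; _,_; proj₂)
open import Data.Sum using (_⊎_; inj₁; inj₂)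
open import Relation.Nullary using (¬_; Dec; yes; no; contradiction)
open import Relation.Nullary.Decidable using (_×-dec_)
open import Relation.Binary.Definitions using (DecidableEquality)
open import Relation.Binary.PropositionalEquality using (_≡_; _≢_; refl)
open import Relation.Binary.Construct.Closure.Symmetric using (fwd; bwd)
open import Relation.Binary.Construct.Closure.ReflexiveTransitive using (ε; _◅_)
open import Function.Bundles using (_⇔_; Equivalence)

-- Some item of type u occurs strictly before some item of type v in w.
-- For lists of vertices, `SeqArc w u v` is exactly `u ≢ v × Precedes w u v`.
Precedes : ∀ {A : Set} → List A → A → A → Set
Precedes w u v = ∃ λ i → ∃ λ j → (i <ᶠ j) × (lookup w i ≡ u) × (lookup w j ≡ v)

precedes? : ∀ {A : Set} → DecidableEquality A →
            (w : List A) (u v : A) → Dec (Precedes w u v)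
precedes? _≟ᴬ_ w u v =
  any? λ i → any? λ j → (i <ᶠ? j) ×-dec ((lookup w i ≟ᴬ u) ×-dec (lookup w j ≟ᴬ v))

-- Crossing lemma.  Let c sit at position i before b at j, and a at i' before
-- d at j'.  If i < j' then c precedes d; otherwise i' < j' ≤ i < j, so a
-- precedes b.
precedes-cross : ∀ {A : Set} (w : List A) {a b c d : A} →
                 Precedes w c b → Precedes w a d →
                 Precedes w c d ⊎ Precedes w a b
precedes-cross w (i , j , i<j , wi≡c , wj≡b) (i' , j' , i'<j' , wi'≡a , wj'≡d)
  with i <ᶠ? j'
... | yes i<j' = inj₁ (i , j' , i<j' , wi≡c , wj'≡d)
... | no  i≮j' = inj₂ (i' , j , i'<j , wi'≡a , wj≡b)
  where
  i'<j : i' <ᶠ j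
  i'<j = ℕ.<-trans (ℕ.<-≤-trans i'<j' (ℕ.≮⇒≥ i≮j')) i<j

ArcOrEqual : (H : Digraph) → Fin (n H) → Fin (n H) → Set
ArcOrEqual H u v = u ≡ v ⊎ Arc H u v

arcs-weakly-connected : (H : Digraph) {a b c d : Fin (n H)} →
                        Arc H a b → Arc H c d →
                        ArcOrEqual H c b ⊎ ArcOrEqual H a d →
                        WeaklyConnected H a c
arcs-weakly-connected H ab cd (inj₁ (inj₁ refl)) = fwd ab ◅ ε
arcs-weakly-connected H ab cd (inj₁ (inj₂ cb))   = fwd ab ◅ bwd cb ◅ ε
arcs-weakly-connected H ab cd (inj₂ (inj₁ refl)) = bwd cd ◅ ε
arcs-weakly-connected H ab cd (inj₂ (inj₂ ad))   = fwd ad ◅ bwd cd ◅ ε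

module SequenceComplement (G : Digraph) (w : List (Fin (n G)))
         (arcs : (u v : Fin (n G)) → Arc G u v ⇔ SeqArc w u v) where

  complement-arc : ∀ {u v} → u ≢ v → ¬ Precedes w u v → Arc (complement G) u v
  complement-arc u≢v ¬u<v = u≢v , λ uv → ¬u<v (proj₂ (Equivalence.to (arcs _ _) uv))

  complement-arc⁻¹ : ∀ {u v} → Arc (complement G) u v → ¬ Precedes w u v
  complement-arc⁻¹ (u≢v , ¬uv) u<v = ¬uv (Equivalence.from (arcs _ _) (u≢v , u<v))

  arc-or-precedes : ∀ u v → ArcOrEqual (complement G) u v ⊎ Precedes w u v
  arc-or-precedes u v with u ≟ v | precedes? _≟_ w u v
  ... | yes u≡v | _        = inj₁ (inj₁ u≡v)
  ... | no  _   | yes u<v  = inj₂ u<v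
  ... | no  u≢v | no  ¬u<v = inj₁ (inj₂ (complement-arc u≢v ¬u<v))

  -- For complement arcs a → b and c → d, c is joined to b or a is joined
  -- to d in the complement: if c precedes b and a precedes d, the crossing
  -- lemma would make c precede d or a precede b.
  complement-arcs-linked : ∀ {a b c d} →
                           Arc (complement G) a b → Arc (complement G) c d →
                           ArcOrEqual (complement G) c b ⊎ ArcOrEqual (complement G) a d
  complement-arcs-linked {a} {b} {c} {d} ab cd
    with arc-or-precedes c b | arc-or-precedes a d
  ... | inj₁ cb  | _        = inj₁ cb
  ... | inj₂ _   | inj₁ ad  = inj₂ ad
  ... | inj₂ c<b | inj₂ a<d with precedes-cross w c<b a<d
  ...   | inj₁ c<d = contradiction c<d (complement-arc⁻¹ cd)
  ...   | inj₂ a<b = contradiction a<b (complement-arc⁻¹ ab)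

proposition4p50 : (ℓ : ℕ) → ℓ ≥ 1 → (G : Digraph) → InS1 ℓ G →
                  AtMostOneArcComponent (complement G)
proposition4p50 _ _ G (w , _ , _ , arcs) ab cd =
  arcs-weakly-connected (complement G) ab cd (complement-arcs-linked ab cd)
  where open SequenceComplement G w arcs
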